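{- Let $G=(X,Y,E)$ be a 2-layer network in which every vertex of $Y$ has degree at least $1$, let $<_X$ be a linear order of $X$ such that the one-sided local crossing number of $(G,<_X)$ is $k$, and let $<_{\mathsf A}$ be any order of $Y$ that can be returned by heuristic $\mathsf A$. Then every heavy edge crosses at most $3k$ edges in the 2-layer drawing $(<_X,<_{\mathsf A})$.
   Context: A 2-layer network $(X,Y,E)$ is a finite bipartite graph with vertex set $X\cup Y$, $X\cap Y=\emptyset$, edges written $(x,y)$ with $x\in X,y\in Y$. A 2-layer drawing is a pair $(<_X,<_Y)$ of linear orders of $X$ and $Y$; edges $(x_1,y_1),(x_2,y_2)$ cross iff $(x_1<_X x_2\wedge y_2<_Y y_1)$ or $(x_2<_X x_1\wedge y_1<_Y y_2)$. The local crossing number of a drawing is the minimum $k$ such that every edge crosses at most $k$ edges; the one-sided local crossing number of $(G,<_X)$ is the minimum over all linear orders $<_Y$ of $Y$ of the local crossing number of $(<_X,<_Y)$. Heuristic $\mathsf A$: for each $y\in Y$ list its neighbors in increasing $<_X$ order (1-indexed). The median $\mathrm{med}(y)$ is the 2nd neighbor if $\deg(y)=2$, and the $\lfloor \deg(y)/2\rfloor$-th neighbor if $\deg(y)\neq 2$. Call $y$ a 2-vertex if $\deg(y)=2$, an odd vertex if $\deg(y)$ is odd, and a $4^{\oplus}$-vertex if $\deg(y)$ is even and at least $4$. For a 2-vertex $y$, its heavy neighbor is its neighbor $w$ other than $\mathrm{med}(y)$, and $(w,y)$ is called a heavy edge. The bunch of $x\in X$ is $\{y\in Y:\mathrm{med}(y)=x\}$.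 The output $<_{\mathsf A}$ is a linear order of $Y$ with $y_1<_{\mathsf A}y_2$ whenever $\mathrm{med}(y_1)<_X\mathrm{med}(y_2)$, and within each bunch: first the 2-vertices in ascending $<_X$-order of their heavy neighbors (ties broken arbitrarily), then the odd vertices in any order, then the $4^{\oplus}$-vertices in ascending order of degree (ties broken arbitrarily). -}

module Defs where

open import Data.Bool using (Bool; true; false; _∧_; if_then_else_)
open import Data.Nat using (ℕ; zero; suc; _+_; _*_; _∸_; _<_; _≤_; _<ᵇ_; _≡ᵇ_; _/_)
open import Data.Nat.Properties using ()
open import Data.Fin using (Fin; zero; suc)
open import Data.Product using (Σ; ∃; _×_; _,_)
open import Data.Sum using (_⊎_)
open import Relation.Binary.PropositionalEquality using (_≡_; _≢_)
open import Relation.Nullary using (¬_)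
open import Function.Definitions using (Injective)

-- A 2-layer network with X = Fin m, Y = Fin n; edges given by a Boolean
-- adjacency relation E x y.  A linear order on a finite set A is encoded by an
-- injective rank function r : A → ℕ  (a < b iff r a < r b).

sumFin : {n : ℕ} → (Fin n → ℕ) → ℕ
sumFin {zero}  f = 0
sumFin {suc n} f = f zero + sumFin (λ i → f (suc i))

countFin : {n : ℕ} → (Fin n → Bool) → ℕ
countFin p = sumFin (λ i → if p i then 1 else 0)

LinOrd : ℕ → Set
LinOrd k = Σ (Fin k → ℕ) λ r → Injective _≡_ _≡_ r

module _ {m n : ℕ} (E : Fin m → Fin n → Bool) where

  deg : Fin n → ℕ
  deg y = countFin (λ x → E x y)

  crossᵇ : (Fin m → ℕ) → (Fin n → ℕ) → Fin m → Fin n → Fin m → Fin n → Bool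
  crossᵇ rX rY x₁ y₁ x₂ y₂ =
    if (rX x₁ <ᵇ rX x₂) ∧ (rY y₂ <ᵇ rY y₁) then true
    else ((rX x₂ <ᵇ rX x₁) ∧ (rY y₁ <ᵇ rY y₂))

  crossings : (Fin m → ℕ) → (Fin n → ℕ) → Fin m → Fin n → ℕ
  crossings rX rY x y =
    sumFin (λ x' → countFin (λ y' → E x' y' ∧ crossᵇ rX rY x y x' y'))

  LCN≤ : (Fin m → ℕ) → (Fin n → ℕ) → ℕ → Set
  LCN≤ rX rY k = ∀ x y → E x y ≡ true → crossings rX rY x y ≤ k

  OneSidedLCN : (Fin m → ℕ) → ℕ → Set
  OneSidedLCN rX k =
    (Σ (LinOrd n) λ { (rY , _) → LCN≤ rX rY k }) ×
    (∀ (σ : LinOrd n) k' → LCN≤ rX (Data.Product.proj₁ σ) k' → k ≤ k')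

  before : (Fin m → ℕ) → Fin n → Fin m → ℕ
  before rX y x = countFin (λ x' → E x' y ∧ (rX x' <ᵇ rX x))

  -- (1-indexed) position of the median among the sorted neighbours, minus 1:
  -- 2nd neighbour if deg = 2, otherwise the ⌈deg/2⌉-th neighbour.
  medPred : ℕ → ℕ
  medPred d = if d ≡ᵇ 2 then 1 else ((d ∸ 1) / 2)

  IsMed : (Fin m → ℕ) → Fin n → Fin m → Set
  IsMed rX y x = (E x y ≡ true) × (before rX y x ≡ medPred (deg y))

  IsHeavyEdge : (Fin m → ℕ) → Fin m → Fin n → Set
  IsHeavyEdge rX w y = (deg y ≡ 2) × (E w y ≡ true) × (¬ IsMed rX y w)

  HeavyNbr : (Fin m → ℕ) → Fin n → Fin m → Set
  HeavyNbr rX y w = IsHeavyEdge rX w y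

  Odd : ℕ → Set
  Odd d = Σ ℕ λ t → d ≡ suc (t * 2)

  Even4 : ℕ → Set
  Even4 d = Σ ℕ λ t → d ≡ 4 + t * 2

  AOutput : (Fin m → ℕ) → (Fin n → ℕ) → Set
  AOutput rX rA =
    (∀ y₁ y₂ x₁ x₂ → IsMed rX y₁ x₁ → IsMed rX y₂ x₂ →
       rX x₁ < rX x₂ → rA y₁ < rA y₂) ×
    (∀ y₁ y₂ x → IsMed rX y₁ x → IsMed rX y₂ x →
       deg y₁ ≡ 2 → Odd (deg y₂) → rA y₁ < rA y₂) ×
    (∀ y₁ y₂ x → IsMed rX y₁ x → IsMed rX y₂ x →
       deg y₁ ≡ 2 → Even4 (deg y₂) → rA y₁ < rA y₂) ×
    (∀ y₁ y₂ x → IsMed rX y₁ x → IsMed rX y₂ x →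
       Odd (deg y₁) → Even4 (deg y₂) → rA y₁ < rA y₂) ×
    (∀ y₁ y₂ x w₁ w₂ → IsMed rX y₁ x → IsMed rX y₂ x →
       HeavyNbr rX y₁ w₁ → HeavyNbr rX y₂ w₂ →
       rX w₁ < rX w₂ → rA y₁ < rA y₂) ×
    (∀ y₁ y₂ x → IsMed rX y₁ x → IsMed rX y₂ x →
       Even4 (deg y₁) → Even4 (deg y₂) → deg y₁ < deg y₂ → rA y₁ < rA y₂)

{-# OPTIONS --safe #-}
-- Let (a, y) be a heavy edge and b = med(y), so that a < b are the two neighbours of y, and
-- let <_Y be an order of Y attaining local crossing number k.  Counted vertex by vertex
-- of Y, the crossings of (a, y) at y′ are the same in both drawings unless y′ lies on
-- different sides of y in <_A and <_Y.  If y′ follows y in <_A, then med(y′) is not left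
-- of b, and when med(y′) = b and y′ is a 2-vertex the heavy-neighbour order puts all
-- neighbours of y′ right of a; so y′ has at most as many neighbours left of a as right
-- of b.  If y′ precedes y in <_A, then med(y′) is left of b, or med(y′) = b and y′ is a
-- 2-vertex (odd and 4⊕-vertices follow the 2-vertices of their bunch); either way y′ has
-- at most twice as many neighbours as it has left of b.
-- Hence cr_A(a, y) ≤ cr_Y(a, y) + 2 cr_Y(b, y) ≤ 3k.
module Submission where

open import Defs
open import Data.Bool using (Bool; true; false; not; _∧_; if_then_else_)
open import Data.Bool.Properties using (T-≡; ¬-not; ∧-identityʳ; ∧-zeroʳ)
open import Data.Fin using (Fin; zero; suc)
import Data.Fin.Properties as Fin
open import Data.Nat using (ℕ; zero; suc; _+_; _*_; _∸_; _/_; _%_; _≤_; _<_; _<ᵇ_; z≤n; s≤s; _⊔_; _<?_; _≟_)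
open import Data.Nat.Properties
open import Algebra.Properties.Semiring.Sum +-*-semiring
  using (sum; sum-cong-≗; sum-replicate-zero; ∑-comm; ∑-distrib-+; *-distribˡ-sum)
open import Data.Nat.DivMod using (m≡m%n+[m/n]*n; m%n<n)
open import Data.Product using (∃-syntax; _×_; _,_; proj₁; proj₂)
open import Data.Sum using (_⊎_; inj₁; inj₂)
open import Function.Base using (_∘_)
open import Function.Bundles using (Equivalence)
open import Function.Definitions using (Injective)
open import Relation.Binary.Definitions using (tri<; tri≈; tri>)
open import Relation.Binary.PropositionalEquality
open import Relation.Nullary using (¬_; yes; no; contradiction)

sumFin≡sum : ∀ {n} (f : Fin n → ℕ) → sumFin f ≡ sum f
sumFin≡sum {zero}  f = refl
sumFin≡sum {suc n} f = cong (f zero +_) (sumFin≡sum (λ i → f (suc i)))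

sumFin-cong : ∀ {n} {f g : Fin n → ℕ} → (∀ i → f i ≡ g i) → sumFin f ≡ sumFin g
sumFin-cong {f = f} {g} f≗g = begin
  sumFin f ≡⟨ sumFin≡sum f ⟩
  sum f    ≡⟨ sum-cong-≗ f≗g ⟩
  sum g    ≡⟨ sumFin≡sum g ⟨
  sumFin g ∎
  where open ≡-Reasoning

sumFin-zero : ∀ n → sumFin {n} (λ _ → 0) ≡ 0
sumFin-zero n = trans (sumFin≡sum {n} (λ _ → 0)) (sum-replicate-zero n)

sumFin-distrib-+ : ∀ {n} (f g : Fin n → ℕ) →
                   sumFin (λ i → f i + g i) ≡ sumFin f + sumFin g
sumFin-distrib-+ f g = begin
  sumFin (λ i → f i + g i) ≡⟨ sumFin≡sum (λ i → f i + g i) ⟩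
  sum (λ i → f i + g i)    ≡⟨ ∑-distrib-+ f g ⟩
  sum f + sum g            ≡⟨ cong₂ _+_ (sumFin≡sum f) (sumFin≡sum g) ⟨
  sumFin f + sumFin g      ∎
  where open ≡-Reasoning

sumFin-distribˡ-* : ∀ {n} c (f : Fin n → ℕ) → c * sumFin f ≡ sumFin (λ i → c * f i)
sumFin-distribˡ-* c f = begin
  c * sumFin f           ≡⟨ cong (c *_) (sumFin≡sum f) ⟩
  c * sum f              ≡⟨ *-distribˡ-sum c f ⟩
  sum (λ i → c * f i)    ≡⟨ sumFin≡sum (λ i → c * f i) ⟨
  sumFin (λ i → c * f i) ∎
  where open ≡-Reasoning

sumFin-comm : ∀ {m n} (h : Fin m → Fin n → ℕ) →
              sumFin (λ i → sumFin (h i)) ≡ sumFin (λ j → sumFin (λ i → h i j))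
sumFin-comm h = begin
  sumFin (λ i → sumFin (h i))          ≡⟨ sumFin≡sum (λ i → sumFin (h i)) ⟩
  sum (λ i → sumFin (h i))             ≡⟨ sum-cong-≗ (λ i → sumFin≡sum (h i)) ⟩
  sum (λ i → sum (h i))                ≡⟨ ∑-comm h ⟩
  sum (λ j → sum (λ i → h i j))        ≡⟨ sum-cong-≗ (λ j → sumFin≡sum (λ i → h i j)) ⟨
  sum (λ j → sumFin (λ i → h i j))     ≡⟨ sumFin≡sum (λ j → sumFin (λ i → h i j)) ⟨
  sumFin (λ j → sumFin (λ i → h i j))  ∎
  where open ≡-Reasoning

sumFin-mono-≤ : ∀ {n} {f g : Fin n → ℕ} → (∀ i → f i ≤ g i) → sumFin f ≤ sumFin g
sumFin-mono-≤ {zero}  f≤g = z≤n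
sumFin-mono-≤ {suc n} f≤g = +-mono-≤ (f≤g zero) (sumFin-mono-≤ (λ i → f≤g (suc i)))

module _ {n : ℕ} where

  countFin-cong : {p q : Fin n → Bool} → (∀ i → p i ≡ q i) → countFin p ≡ countFin q
  countFin-cong p≗q = sumFin-cong (λ i → cong (λ b → if b then 1 else 0) (p≗q i))

  countFin-none : {p : Fin n → Bool} → (∀ i → p i ≡ false) → countFin p ≡ 0
  countFin-none p≗false = trans (countFin-cong p≗false) (sumFin-zero n)

  countFin-split : (p q : Fin n → Bool) →
                   countFin p ≡ countFin (λ i → p i ∧ q i) + countFin (λ i → p i ∧ not (q i))
  countFin-split p q = trans (sumFin-cong (λ i → split (p i) (q i))) (sumFin-distrib-+ {n} _ _)
    where
    split : ∀ b c → (if b then 1 else 0) ≡ (if b ∧ c then 1 else 0) + (if b ∧ not c then 1 else 0)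
    split false _     = refl
    split true  true  = refl
    split true  false = refl

indicator-mono : ∀ {b c} → (b ≡ true → c ≡ true) → (if b then 1 else 0) ≤ (if c then 1 else 0)
indicator-mono {false} _   = z≤n
indicator-mono {true}  b⇒c rewrite b⇒c refl = ≤-refl

countFin-mono : ∀ {n} {p q : Fin n → Bool} → (∀ i → p i ≡ true → q i ≡ true) →
                countFin p ≤ countFin q
countFin-mono p⊆q = sumFin-mono-≤ (λ i → indicator-mono (p⊆q i))

countFin-mono-< : ∀ {n} {p q : Fin n → Bool} → (∀ i → p i ≡ true → q i ≡ true) →
                  ∀ j → p j ≡ false → q j ≡ true → countFin p < countFin q
countFin-mono-< {suc n} {p} {q} p⊆q zero pj qj rewrite pj | qj =
  s≤s (countFin-mono (λ i → p⊆q (suc i)))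
countFin-mono-< p⊆q (suc j) pj qj =
  +-mono-≤-< (indicator-mono (p⊆q zero)) (countFin-mono-< (λ i → p⊆q (suc i)) j pj qj)

countFin-<⇒∃ : ∀ {n} {p q : Fin n → Bool} → countFin p < countFin q →
               ∃[ i ] q i ≡ true × p i ≡ false
countFin-<⇒∃ {suc n} {p} {q} p<q with p zero in p0 | q zero in q0
... | false | true  = zero , q0 , p0
... | true  | true  with i , qi , pi ← countFin-<⇒∃ (≤-pred p<q) = suc i , qi , pi
... | true  | false with i , qi , pi ← countFin-<⇒∃ (<⇒≤ p<q) = suc i , qi , pi
... | false | false with i , qi , pi ← countFin-<⇒∃ p<q = suc i , qi , pi

countFin-≤1 : ∀ {n} {p : Fin n → Bool} → (∀ i j → p i ≡ true → p j ≡ true → i ≡ j) →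
              countFin p ≤ 1
countFin-≤1 {zero} _ = z≤n
countFin-≤1 {suc n} {p} unique with p zero in p0
... | true  = ≤-reflexive (cong suc (countFin-none λ i →
                ¬-not (λ pi → Fin.0≢1+n (unique zero (suc i) p0 pi))))
... | false = countFin-≤1 (λ i j pi pj → Fin.suc-injective (unique (suc i) (suc j) pi pj))

∧-true⇒ : ∀ {b c} → b ∧ c ≡ true → b ≡ true × c ≡ true
∧-true⇒ {true} {true} _ = refl , refl

∧-false-right : ∀ {b c} → b ≡ true → b ∧ c ≡ false → c ≡ false
∧-false-right refl c≡false = c≡false

if-then-true-else-false : ∀ b → (if b then true else false) ≡ b
if-then-true-else-false true  = refl
if-then-true-else-false false = refl

<⇒<ᵇ≡true : ∀ {a b} → a < b → (a <ᵇ b) ≡ true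
<⇒<ᵇ≡true a<b = Equivalence.to T-≡ (<⇒<ᵇ a<b)

<ᵇ≡true⇒< : ∀ {a b} → (a <ᵇ b) ≡ true → a < b
<ᵇ≡true⇒< {a} {b} a<ᵇb = <ᵇ⇒< a b (Equivalence.from T-≡ a<ᵇb)

≤⇒<ᵇ≡false : ∀ {a b} → b ≤ a → (a <ᵇ b) ≡ false
≤⇒<ᵇ≡false b≤a = ¬-not (λ a<ᵇb → ≤⇒≯ b≤a (<ᵇ≡true⇒< a<ᵇb))

<ᵇ≡false⇒≤ : ∀ {a b} → (a <ᵇ b) ≡ false → b ≤ a
<ᵇ≡false⇒≤ a≮ᵇb = ≮⇒≥ (λ a<b → contradiction (trans (sym (<⇒<ᵇ≡true a<b)) a≮ᵇb) λ ())

not≡true⇒≡false : ∀ {b} → not b ≡ true → b ≡ false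
not≡true⇒≡false {false} _ = refl

<ᵇ-irrefl : ∀ a → (a <ᵇ a) ≡ false
<ᵇ-irrefl zero    = refl
<ᵇ-irrefl (suc a) = <ᵇ-irrefl a

not-<ᵇ-suc : ∀ a t → not (a <ᵇ suc t) ≡ (t <ᵇ a)
not-<ᵇ-suc zero    t       = refl
not-<ᵇ-suc (suc a) zero    = refl
not-<ᵇ-suc (suc a) (suc t) = not-<ᵇ-suc a t

<ᵇ-suc⇒≡ : ∀ {a t} → (a <ᵇ suc t) ≡ true → (a <ᵇ t) ≡ false → a ≡ t
<ᵇ-suc⇒≡ a<1+t a≮t = ≤-antisym (≤-pred (<ᵇ≡true⇒< a<1+t)) (<ᵇ≡false⇒≤ a≮t)

half-bounds : ∀ e → 2 * (e / 2) ≤ e × e ≤ suc (2 * (e / 2))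
half-bounds e =
    subst (2 * (e / 2) ≤_) (sym e≡) (m≤n+m _ (e % 2))
  , subst (_≤ suc (2 * (e / 2))) (sym e≡) (+-monoˡ-≤ _ (≤-pred (m%n<n e 2)))
  where
  e≡ : e ≡ e % 2 + 2 * (e / 2)
  e≡ = trans (m≡m%n+[m/n]*n e 2) (cong (e % 2 +_) (*-comm (e / 2) 2))

module _ {m n : ℕ} (E : Fin m → Fin n → Bool) where

  medPred-≢2 : ∀ {d} → d ≢ 2 → medPred E d ≡ (d ∸ 1) / 2
  medPred-≢2 {0}                   _   = refl
  medPred-≢2 {1}                   _   = refl
  medPred-≢2 {2}                   2≢2 = contradiction refl 2≢2
  medPred-≢2 {suc (suc (suc _))}   _   = refl

  2*medPred< : ∀ {d} → 1 ≤ d → d ≢ 2 → 2 * medPred E d < d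
  2*medPred< {suc d} _ d≢2 rewrite medPred-≢2 d≢2 = s≤s (proj₁ (half-bounds d))

  2*medPred≤ : ∀ d → 2 * medPred E d ≤ d
  2*medPred≤ 0 = z≤n
  2*medPred≤ d@(suc _) with d ≟ 2
  ... | yes refl = ≤-refl
  ... | no d≢2 = <⇒≤ (2*medPred< (s≤s z≤n) d≢2)

  medPred-< : ∀ {d} → 1 ≤ d → medPred E d < d
  medPred-< {d} 1≤d with d ≟ 2
  ... | yes refl = s≤s (s≤s z≤n)
  ... | no d≢2 = ≤-<-trans (m≤m+n _ _) (2*medPred< 1≤d d≢2)

  ≤2*suc-medPred : ∀ d → d ≤ 2 * suc (medPred E d)
  ≤2*suc-medPred d with d ≟ 2
  ... | yes refl = s≤s (s≤s z≤n)
  ... | no d≢2 rewrite medPred-≢2 d≢2 = begin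
    d                           ≤⟨ m≤n+m∸n d 1 ⟩
    suc (d ∸ 1)                 ≤⟨ s≤s (proj₂ (half-bounds (d ∸ 1))) ⟩
    2 + 2 * ((d ∸ 1) / 2)       ≡⟨ *-distribˡ-+ 2 1 ((d ∸ 1) / 2) ⟨
    2 * suc ((d ∸ 1) / 2)       ∎
    where open ≤-Reasoning

  odd-or-even4 : ∀ {d} → 1 ≤ d → d ≢ 2 → Odd E d ⊎ Even4 E d
  odd-or-even4 {1} _ _   = inj₁ (0 , refl)
  odd-or-even4 {2} _ 2≢2 = contradiction refl 2≢2
  odd-or-even4 {3} _ _   = inj₁ (1 , refl)
  odd-or-even4 {4} _ _   = inj₂ (0 , refl)
  odd-or-even4 {suc (suc d@(suc (suc (suc _))))} _ _ with odd-or-even4 {d} (s≤s z≤n) (λ ())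
  ... | inj₁ (t , d≡) = inj₁ (suc t , cong (2 +_) d≡)
  ... | inj₂ (t , d≡) = inj₂ (suc t , cong (2 +_) d≡)

rank-bound : ∀ {m} (r : Fin m → ℕ) → ∃[ T ] (∀ x → r x < T)
rank-bound {zero}  r = 0 , λ ()
rank-bound {suc m} r with T , r<T ← rank-bound (λ x → r (suc x)) =
  suc (r zero) ⊔ T , λ { zero    → m≤m⊔n (suc (r zero)) T
                      ; (suc x) → ≤-trans (r<T x) (m≤n⊔m (suc (r zero)) T) }

module Neighbours {m n : ℕ} (E : Fin m → Fin n → Bool) (r : Fin m → ℕ) where

  -- `before E r y x` is `leftNbrs y (r x)`, so `IsMed E r y x` says that x is a neighbour
  -- of y with exactly `medPred E (deg E y)` neighbours of y to its left.
  leftNbrs : Fin n → ℕ → ℕ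
  leftNbrs y t = countFin (λ x → E x y ∧ (r x <ᵇ t))

  rightNbrs : Fin n → ℕ → ℕ
  rightNbrs y t = countFin (λ x → E x y ∧ (t <ᵇ r x))

  module _ {y : Fin n} where

    leftNbrs-zero : leftNbrs y 0 ≡ 0
    leftNbrs-zero = countFin-none {m} (λ x → ∧-zeroʳ (E x y))

    leftNbrs-all : ∀ {T} → (∀ x → r x < T) → leftNbrs y T ≡ deg E y
    leftNbrs-all r<T = countFin-cong {m} λ x →
      trans (cong (E x y ∧_) (<⇒<ᵇ≡true (r<T x))) (∧-identityʳ (E x y))

    leftNbrs≤deg : ∀ t → leftNbrs y t ≤ deg E y
    leftNbrs≤deg t = countFin-mono {m} (λ x → proj₁ ∘ ∧-true⇒)

    rightNbrs≤deg : ∀ t → rightNbrs y t ≤ deg E y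
    rightNbrs≤deg t = countFin-mono {m} (λ x → proj₁ ∘ ∧-true⇒)

    leftNbrs+rightNbrs : ∀ t → leftNbrs y (suc t) + rightNbrs y t ≡ deg E y
    leftNbrs+rightNbrs t = sym (trans (countFin-split (λ x → E x y) (λ x → r x <ᵇ suc t))
      (cong (leftNbrs y (suc t) +_) (countFin-cong {m} (λ x → cong (E x y ∧_) (not-<ᵇ-suc (r x) t)))))

    leftNbrs-mono : ∀ {t t′} → t ≤ t′ → leftNbrs y t ≤ leftNbrs y t′
    leftNbrs-mono t≤t′ = countFin-mono {m} λ x x∈ →
      let exy , x<t = ∧-true⇒ x∈ in cong₂ _∧_ exy (<⇒<ᵇ≡true (<-≤-trans (<ᵇ≡true⇒< x<t) t≤t′))

    leftNbrs-< : ∀ {x t} → E x y ≡ true → r x < t → leftNbrs y (r x) < leftNbrs y t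
    leftNbrs-< {x} {t} exy x<t = countFin-mono-< {m} before⊆ x x∉ x∈
      where
      before⊆ : ∀ x′ → E x′ y ∧ (r x′ <ᵇ r x) ≡ true → E x′ y ∧ (r x′ <ᵇ t) ≡ true
      before⊆ x′ x′∈ = let ex′y , x′<x = ∧-true⇒ x′∈ in
        cong₂ _∧_ ex′y (<⇒<ᵇ≡true (<-trans (<ᵇ≡true⇒< x′<x) x<t))
      x∉ : E x y ∧ (r x <ᵇ r x) ≡ false
      x∉ = trans (cong (E x y ∧_) (<ᵇ-irrefl (r x))) (∧-zeroʳ (E x y))
      x∈ : E x y ∧ (r x <ᵇ t) ≡ true
      x∈ = cong₂ _∧_ exy (<⇒<ᵇ≡true x<t)

    leftNbrs-jump : ∀ {t} → leftNbrs y t < leftNbrs y (suc t) →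
                    ∃[ x ] E x y ≡ true × r x ≡ t
    leftNbrs-jump jump with x , x∈ , x∉ ← countFin-<⇒∃ {m} jump =
      let exy , x<1+t = ∧-true⇒ x∈ in x , exy , <ᵇ-suc⇒≡ x<1+t (∧-false-right exy x∉)

    leftNbrs≤medPred : ∀ {x t} → IsMed E r y x → t ≤ r x → leftNbrs y t ≤ medPred E (deg E y)
    leftNbrs≤medPred (_ , x-pos) t≤x = ≤-trans (leftNbrs-mono t≤x) (≤-reflexive x-pos)

    medPred<leftNbrs : ∀ {x t} → IsMed E r y x → r x < t → medPred E (deg E y) < leftNbrs y t
    medPred<leftNbrs (exy , x-pos) x<t = subst (_< _) x-pos (leftNbrs-< exy x<t)

    ¬IsMed-below : ∀ {x b} → IsMed E r y b → r x < r b → ¬ IsMed E r y x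
    ¬IsMed-below (_ , b-pos) x<b (exy , x-pos) = <⇒≢ (leftNbrs-< exy x<b) (trans x-pos (sym b-pos))

    module _ (r-inj : Injective _≡_ _≡_ r) where

      leftNbrs-suc≤ : ∀ t → leftNbrs y (suc t) ≤ suc (leftNbrs y t)
      leftNbrs-suc≤ t = begin
        leftNbrs y (suc t)
          ≡⟨ countFin-split (λ x → E x y ∧ (r x <ᵇ suc t)) (λ x → r x <ᵇ t) ⟩
        countFin (λ x → (E x y ∧ (r x <ᵇ suc t)) ∧ (r x <ᵇ t)) +
        countFin (λ x → (E x y ∧ (r x <ᵇ suc t)) ∧ not (r x <ᵇ t))
          ≤⟨ +-mono-≤ (countFin-mono {m} below-t) (countFin-≤1 {m} at-t-unique) ⟩
        leftNbrs y t + 1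
          ≡⟨ +-comm _ 1 ⟩
        suc (leftNbrs y t) ∎
        where
        open ≤-Reasoning
        below-t : ∀ x → (E x y ∧ (r x <ᵇ suc t)) ∧ (r x <ᵇ t) ≡ true → E x y ∧ (r x <ᵇ t) ≡ true
        below-t x x∈ = let x∈′ , x<t = ∧-true⇒ {E x y ∧ (r x <ᵇ suc t)} x∈ in
          cong₂ _∧_ (proj₁ (∧-true⇒ x∈′)) x<t
        at-t : ∀ x → (E x y ∧ (r x <ᵇ suc t)) ∧ not (r x <ᵇ t) ≡ true → r x ≡ t
        at-t x x∈ = let x∈′ , x≮t = ∧-true⇒ {E x y ∧ (r x <ᵇ suc t)} x∈ in
          <ᵇ-suc⇒≡ (proj₂ (∧-true⇒ x∈′)) (not≡true⇒≡false x≮t)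
        at-t-unique : ∀ i j → (E i y ∧ (r i <ᵇ suc t)) ∧ not (r i <ᵇ t) ≡ true →
                      (E j y ∧ (r j <ᵇ suc t)) ∧ not (r j <ᵇ t) ≡ true → i ≡ j
        at-t-unique i j i∈ j∈ = r-inj (trans (at-t i i∈) (sym (at-t j j∈)))

      nbr-at-each-position : ∀ t {j} → j < leftNbrs y t →
                             ∃[ x ] E x y ≡ true × leftNbrs y (r x) ≡ j
      nbr-at-each-position zero j<0 = contradiction (subst (_ <_) leftNbrs-zero j<0) n≮0
      nbr-at-each-position (suc t) {j} j<L with j <? leftNbrs y t
      ... | yes j<Lt = nbr-at-each-position t j<Lt
      ... | no  j≮Lt =
        let x , exy , rx≡t = leftNbrs-jump (≤-<-trans (≮⇒≥ j≮Lt) j<L) in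
        x , exy , trans (cong (leftNbrs y) rx≡t) (sym j≡Lt)
        where
        j≡Lt : j ≡ leftNbrs y t
        j≡Lt = ≤-antisym (≤-pred (≤-trans j<L (leftNbrs-suc≤ t))) (≮⇒≥ j≮Lt)

      median-exists : 1 ≤ deg E y → ∃[ x ] IsMed E r y x
      median-exists deg≥1 =
        let T , r<T = rank-bound r in
        nbr-at-each-position T
          (subst (medPred E (deg E y) <_) (sym (leftNbrs-all r<T)) (medPred-< E deg≥1))

      leftNbrs-suc-median : ∀ {x} → IsMed E r y x →
                            leftNbrs y (suc (r x)) ≡ suc (medPred E (deg E y))
      leftNbrs-suc-median x-med@(_ , x-pos) =
        ≤-antisym (≤-trans (leftNbrs-suc≤ _) (s≤s (≤-reflexive x-pos))) (medPred<leftNbrs x-med ≤-refl)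

      heavy<median : ∀ {a b} → IsHeavyEdge E r a y → IsMed E r y b → r a < r b
      heavy<median {a} {b} (deg≡2 , eay , ¬a-med) b-med with <-cmp (r a) (r b)
      ... | tri< a<b _ _ = a<b
      ... | tri≈ _ a≡b _ = contradiction (subst (IsMed E r y) (sym (r-inj a≡b)) b-med) ¬a-med
      ... | tri> _ _ b<a =
        contradiction (subst (λ d → 2 + medPred E d ≤ d) deg≡2 three-nbrs) λ { (s≤s (s≤s ())) }
        where
        open ≤-Reasoning
        three-nbrs : 2 + medPred E (deg E y) ≤ deg E y
        three-nbrs = begin-strict
          1 + medPred E (deg E y) ≤⟨ medPred<leftNbrs b-med b<a ⟩
          leftNbrs y (r a)        <⟨ leftNbrs-< eay ≤-refl ⟩
          leftNbrs y (suc (r a))  ≤⟨ leftNbrs≤deg (suc (r a)) ⟩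
          deg E y                 ∎

module _ {m n : ℕ} (E : Fin m → Fin n → Bool) (rX : Fin m → ℕ) (rY : Fin n → ℕ) where

  open Neighbours E rX using (leftNbrs; rightNbrs)

  crossingsAt : Fin m → Fin n → Fin n → ℕ
  crossingsAt x y y′ = countFin (λ x′ → E x′ y′ ∧ crossᵇ E rX rY x y x′ y′)

  crossings≡sum-crossingsAt : ∀ x y → crossings E rX rY x y ≡ sumFin (crossingsAt x y)
  crossings≡sum-crossingsAt x y =
    sumFin-comm (λ x′ y′ → if E x′ y′ ∧ crossᵇ E rX rY x y x′ y′ then 1 else 0)

  module _ {x x′ : Fin m} {y y′ : Fin n} where

    crossᵇ-tie : rY y′ ≡ rY y → crossᵇ E rX rY x y x′ y′ ≡ false
    crossᵇ-tie y′≡y rewrite y′≡y | <ᵇ-irrefl (rY y) | ∧-zeroʳ (rX x <ᵇ rX x′) =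
      ∧-zeroʳ (rX x′ <ᵇ rX x)

    crossᵇ-below : rY y′ < rY y → crossᵇ E rX rY x y x′ y′ ≡ (rX x <ᵇ rX x′)
    crossᵇ-below y′<y
      rewrite <⇒<ᵇ≡true y′<y | ≤⇒<ᵇ≡false (<⇒≤ y′<y)
            | ∧-identityʳ (rX x <ᵇ rX x′) | ∧-zeroʳ (rX x′ <ᵇ rX x) =
      if-then-true-else-false (rX x <ᵇ rX x′)

    crossᵇ-above : rY y < rY y′ → crossᵇ E rX rY x y x′ y′ ≡ (rX x′ <ᵇ rX x)
    crossᵇ-above y<y′
      rewrite <⇒<ᵇ≡true y<y′ | ≤⇒<ᵇ≡false (<⇒≤ y<y′)
            | ∧-zeroʳ (rX x <ᵇ rX x′) =
      ∧-identityʳ (rX x′ <ᵇ rX x)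

  module _ {x : Fin m} {y y′ : Fin n} where

    crossingsAt-tie : rY y′ ≡ rY y → crossingsAt x y y′ ≡ 0
    crossingsAt-tie y′≡y = countFin-none {m} λ x′ →
      trans (cong (E x′ y′ ∧_) (crossᵇ-tie y′≡y)) (∧-zeroʳ (E x′ y′))

    crossingsAt-below : rY y′ < rY y → crossingsAt x y y′ ≡ rightNbrs y′ (rX x)
    crossingsAt-below y′<y = countFin-cong {m} (λ x′ → cong (E x′ y′ ∧_) (crossᵇ-below y′<y))

    crossingsAt-above : rY y < rY y′ → crossingsAt x y y′ ≡ leftNbrs y′ (rX x)
    crossingsAt-above y<y′ = countFin-cong {m} (λ x′ → cong (E x′ y′ ∧_) (crossᵇ-above y<y′))

≡⇒≤+ : ∀ {c c′ d} → c ≡ c′ → c ≤ c′ + d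
≡⇒≤+ c≡c′ = ≤-trans (≤-reflexive c≡c′) (m≤m+n _ _)

module _ {m n : ℕ} {E : Fin m → Fin n → Bool} {r : Fin m → ℕ} (r-inj : Injective _≡_ _≡_ r)
         (deg≥1 : ∀ y → 1 ≤ deg E y) {rA : Fin n → ℕ} (A : AOutput E r rA)
         {a b : Fin m} {y : Fin n} (a-heavy : IsHeavyEdge E r a y) (b-med : IsMed E r y b) where

  open Neighbours E r

  private
    bunches-ordered : ∀ {y₁ y₂ x₁ x₂} → IsMed E r y₁ x₁ → IsMed E r y₂ x₂ →
                      r x₁ < r x₂ → rA y₁ < rA y₂
    bunches-ordered = proj₁ A _ _ _ _

    2-vertex<odd : ∀ {y₁ y₂ x} → IsMed E r y₁ x → IsMed E r y₂ x →
                   deg E y₁ ≡ 2 → Odd E (deg E y₂) → rA y₁ < rA y₂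
    2-vertex<odd = proj₁ (proj₂ A) _ _ _

    2-vertex<even4 : ∀ {y₁ y₂ x} → IsMed E r y₁ x → IsMed E r y₂ x →
                     deg E y₁ ≡ 2 → Even4 E (deg E y₂) → rA y₁ < rA y₂
    2-vertex<even4 = proj₁ (proj₂ (proj₂ A)) _ _ _

    heavy-nbrs-ordered : ∀ {y₁ y₂ x w₁ w₂} → IsMed E r y₁ x → IsMed E r y₂ x →
                         HeavyNbr E r y₁ w₁ → HeavyNbr E r y₂ w₂ → r w₁ < r w₂ → rA y₁ < rA y₂
    heavy-nbrs-ordered = proj₁ (proj₂ (proj₂ (proj₂ (proj₂ A)))) _ _ _ _ _

    a<b : r a < r b
    a<b = heavy<median r-inj a-heavy b-med

  leftNbrs-heavy≤rightNbrs-median : ∀ {y′} → rA y < rA y′ →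
                                    leftNbrs y′ (r a) ≤ rightNbrs y′ (r b)
  leftNbrs-heavy≤rightNbrs-median {y′} y<y′
    with c , c-med ← median-exists r-inj (deg≥1 y′) | <-cmp (r c) (r b)
  ... | tri< c<b _ _ = contradiction (bunches-ordered c-med b-med c<b) (<⇒≯ y<y′)
  ... | tri> _ _ b<c =
    ≤-trans (leftNbrs≤medPred c-med (<⇒≤ (<-trans a<b b<c))) (+-cancelˡ-≤ p p _ (begin
      p + p                                        ≡⟨ cong (p +_) (+-identityʳ p) ⟨
      2 * p                                        ≤⟨ 2*medPred≤ E (deg E y′) ⟩
      deg E y′                                     ≡⟨ leftNbrs+rightNbrs (r b) ⟨
      leftNbrs y′ (suc (r b)) + rightNbrs y′ (r b) ≤⟨ +-monoˡ-≤ _ (leftNbrs≤medPred c-med b<c) ⟩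
      p + rightNbrs y′ (r b)                       ∎))
    where
    open ≤-Reasoning
    p : ℕ
    p = medPred E (deg E y′)
  ... | tri≈ _ c≡b _ with refl ← r-inj c≡b | deg E y′ ≟ 2
  ...   | no d′≢2 =
    ≤-trans (leftNbrs≤medPred c-med (<⇒≤ a<b)) (+-cancelˡ-≤ (suc p) p _ (begin
      suc (p + p)                                  ≡⟨ cong (λ q → suc (p + q)) (+-identityʳ p) ⟨
      suc (2 * p)                                  ≤⟨ 2*medPred< E (deg≥1 y′) d′≢2 ⟩
      deg E y′                                     ≡⟨ leftNbrs+rightNbrs (r b) ⟨
      leftNbrs y′ (suc (r b)) + rightNbrs y′ (r b)
        ≡⟨ cong (_+ rightNbrs y′ (r b)) (leftNbrs-suc-median r-inj c-med) ⟩
      suc p + rightNbrs y′ (r b)                   ∎))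
    where
    open ≤-Reasoning
    p : ℕ
    p = medPred E (deg E y′)
  ...   | yes d′≡2 = ≤-trans (≤-reflexive (countFin-none {m} no-nbr-left-of-a)) z≤n
    where
    no-nbr-left-of-a : ∀ x → E x y′ ∧ (r x <ᵇ r a) ≡ false
    no-nbr-left-of-a x = ¬-not λ x∈ →
      let ex , x<a = ∧-true⇒ x∈
          x-heavy = d′≡2 , ex , ¬IsMed-below c-med (<-trans (<ᵇ≡true⇒< x<a) a<b)
      in <⇒≯ y<y′ (heavy-nbrs-ordered c-med b-med x-heavy a-heavy (<ᵇ≡true⇒< x<a))

  rightNbrs-heavy≤2*leftNbrs-median : ∀ {y′} → rA y′ < rA y →
                                      rightNbrs y′ (r a) ≤ 2 * leftNbrs y′ (r b)
  rightNbrs-heavy≤2*leftNbrs-median {y′} y′<y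
    with c , c-med ← median-exists r-inj (deg≥1 y′) | <-cmp (r c) (r b)
  ... | tri> _ _ b<c = contradiction (bunches-ordered b-med c-med b<c) (<⇒≯ y′<y)
  ... | tri< c<b _ _ = begin
    rightNbrs y′ (r a)                  ≤⟨ rightNbrs≤deg (r a) ⟩
    deg E y′                            ≤⟨ ≤2*suc-medPred E (deg E y′) ⟩
    2 * suc (medPred E (deg E y′))      ≤⟨ *-monoʳ-≤ 2 (medPred<leftNbrs c-med c<b) ⟩
    2 * leftNbrs y′ (r b)               ∎
    where open ≤-Reasoning
  ... | tri≈ _ c≡b _ with refl ← r-inj c≡b | deg E y′ ≟ 2
  ...   | yes d′≡2 = begin
    rightNbrs y′ (r a)                  ≤⟨ rightNbrs≤deg (r a) ⟩
    deg E y′                            ≡⟨ d′≡2 ⟩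
    2                                   ≡⟨ cong (λ d → 2 * medPred E d) d′≡2 ⟨
    2 * medPred E (deg E y′)            ≡⟨ cong (2 *_) (proj₂ c-med) ⟨
    2 * leftNbrs y′ (r b)               ∎
    where open ≤-Reasoning
  ...   | no d′≢2 with odd-or-even4 E (deg≥1 y′) d′≢2
  ...     | inj₁ odd   = contradiction (2-vertex<odd b-med c-med (proj₁ a-heavy) odd) (<⇒≯ y′<y)
  ...     | inj₂ even4 = contradiction (2-vertex<even4 b-med c-med (proj₁ a-heavy) even4) (<⇒≯ y′<y)

  module _ {rY : Fin n → ℕ} (rY-inj : Injective _≡_ _≡_ rY) where

    heavy-crossingsAt≤ : ∀ y′ → crossingsAt E r rA a y y′ ≤
                            crossingsAt E r rY a y y′ + 2 * crossingsAt E r rY b y y′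
    heavy-crossingsAt≤ y′ with <-cmp (rA y′) (rA y) | <-cmp (rY y′) (rY y)
    ... | tri≈ _ y′≡y _ | _ = ≤-trans (≤-reflexive (crossingsAt-tie E r rA y′≡y)) z≤n
    ... | tri< y′<y _ _ | tri≈ _ y′≡y _ = contradiction (cong rA (rY-inj y′≡y)) (<⇒≢ y′<y)
    ... | tri> _ _ y<y′ | tri≈ _ y′≡y _ = contradiction (cong rA (rY-inj y′≡y)) (>⇒≢ y<y′)
    ... | tri< A-below _ _ | tri< Y-below _ _ = ≡⇒≤+
      (trans (crossingsAt-below E r rA A-below) (sym (crossingsAt-below E r rY Y-below)))
    ... | tri> _ _ A-above | tri> _ _ Y-above = ≡⇒≤+
      (trans (crossingsAt-above E r rA A-above) (sym (crossingsAt-above E r rY Y-above)))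
    ... | tri> _ _ A-above | tri< Y-below _ _ = begin
      crossingsAt E r rA a y y′        ≡⟨ crossingsAt-above E r rA A-above ⟩
      leftNbrs y′ (r a)                ≤⟨ leftNbrs-heavy≤rightNbrs-median A-above ⟩
      rightNbrs y′ (r b)               ≤⟨ m≤n*m _ 2 ⟩
      2 * rightNbrs y′ (r b)           ≡⟨ cong (2 *_) (crossingsAt-below E r rY Y-below) ⟨
      2 * crossingsAt E r rY b y y′    ≤⟨ m≤n+m _ (crossingsAt E r rY a y y′) ⟩
      crossingsAt E r rY a y y′ + 2 * crossingsAt E r rY b y y′ ∎
      where open ≤-Reasoning
    ... | tri< A-below _ _ | tri> _ _ Y-above = begin
      crossingsAt E r rA a y y′        ≡⟨ crossingsAt-below E r rA A-below ⟩
      rightNbrs y′ (r a)               ≤⟨ rightNbrs-heavy≤2*leftNbrs-median A-below ⟩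
      2 * leftNbrs y′ (r b)            ≡⟨ cong (2 *_) (crossingsAt-above E r rY Y-above) ⟨
      2 * crossingsAt E r rY b y y′    ≤⟨ m≤n+m _ (crossingsAt E r rY a y y′) ⟩
      crossingsAt E r rY a y y′ + 2 * crossingsAt E r rY b y y′ ∎
      where open ≤-Reasoning

    heavy-crossings≤ : crossings E r rA a y ≤ crossings E r rY a y + 2 * crossings E r rY b y
    heavy-crossings≤ = begin
      crossings E r rA a y
        ≡⟨ crossings≡sum-crossingsAt E r rA a y ⟩
      sumFin (crossingsAt E r rA a y)
        ≤⟨ sumFin-mono-≤ heavy-crossingsAt≤ ⟩
      sumFin (λ y′ → crossingsAt E r rY a y y′ + 2 * crossingsAt E r rY b y y′)
        ≡⟨ sumFin-distrib-+ (crossingsAt E r rY a y) (λ y′ → 2 * crossingsAt E r rY b y y′) ⟩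
      sumFin (crossingsAt E r rY a y) + sumFin (λ y′ → 2 * crossingsAt E r rY b y y′)
        ≡⟨ cong (sumFin (crossingsAt E r rY a y) +_) (sumFin-distribˡ-* 2 (crossingsAt E r rY b y)) ⟨
      sumFin (crossingsAt E r rY a y) + 2 * sumFin (crossingsAt E r rY b y)
        ≡⟨ cong₂ (λ u v → u + 2 * v) (crossings≡sum-crossingsAt E r rY a y)
                                     (crossings≡sum-crossingsAt E r rY b y) ⟨
      crossings E r rY a y + 2 * crossings E r rY b y ∎
      where open ≤-Reasoning

lemma5 : {m n : ℕ} (E : Fin m → Fin n → Bool) →
    (σX : LinOrd m) → (∀ y → 1 ≤ deg E y) →
    (k : ℕ) → OneSidedLCN E (proj₁ σX) k →
    (σA : LinOrd n) → AOutput E (proj₁ σX) (proj₁ σA) →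
    ∀ w y → IsHeavyEdge E (proj₁ σX) w y →
    crossings E (proj₁ σX) (proj₁ σA) w y ≤ 3 * k
lemma5 E (r , r-inj) deg≥1 k (((rY , rY-inj) , lcn≤k) , _) (rA , _) A w y w-heavy@(_ , ewy , _) =
  let b , b-med@(eby , _) = Neighbours.median-exists E r r-inj (deg≥1 y) in
  begin
    crossings E r rA w y
      ≤⟨ heavy-crossings≤ r-inj deg≥1 A w-heavy b-med rY-inj ⟩
    crossings E r rY w y + 2 * crossings E r rY b y
      ≤⟨ +-mono-≤ (lcn≤k w y ewy) (*-monoʳ-≤ 2 (lcn≤k b y eby)) ⟩
    k + 2 * k
      ∎
  where open ≤-Reasoning
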